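{- There is an algorithm which, given an interval representation of a connected proper interval graph $G$ and a positive integer $C$, produces a $[\lceil(\omega(G)+C-1)/C\rceil,C]$-partition of $G$, where $\omega(G)$ is the maximum size of a clique in $G$.
   Context: A proper interval graph has an interval representation: intervals on the real line, one per vertex, none properly containing another, with distinct vertices adjacent iff their intervals intersect. A $[\lambda,C]$-partition of $G=(V,E)$ is a partition $\{P_1,\dots,P_t\}$ of $V$ such that each $G[P_i]$ is connected, each $|P_i|\le C$, and every clique of $G$ intersects at most $\lambda$ parts. -}

module Defs where

open import Data.Nat using (ℕ; zero; suc; _+_; _∸_; _≤_; _/_; NonZero)
open import Data.Fin using (Fin; _≟_)
open import Data.Fin.Subset using (Subset; _∈_; ∣_∣)
open import Data.Vec using (tabulate)
open import Data.Rational using (ℚ) renaming (_≤_ to _≤ℚ_; _<_ to _<ℚ_)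
open import Data.Product using (Σ; _×_; ∃; ∃-syntax)
open import Data.Sum using (_⊎_)
open import Data.Unit using (⊤)
open import Relation.Nullary using (¬_; does)
open import Relation.Binary.PropositionalEquality using (_≡_; _≢_)

record Interval : Set where
  constructor [_,_]⟨_⟩
  field
    lo : ℚ
    hi : ℚ
    lo≤hi : lo ≤ℚ hi
open Interval public

Intersects : Interval → Interval → Set
Intersects I J = (lo I ≤ℚ hi J) × (lo J ≤ℚ hi I)

ProperlyContainedIn : Interval → Interval → Set
ProperlyContainedIn I J =
  (lo J ≤ℚ lo I) × (hi I ≤ℚ hi J) × ((lo J <ℚ lo I) ⊎ (hi I <ℚ hi J))

-- An interval representation on vertex set Fin n; the graph it represents
-- has u ~ v iff u ≢ v and their intervals intersect.
Rep : ℕ → Set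
Rep n = Fin n → Interval

Adj : ∀ {n} → Rep n → Fin n → Fin n → Set
Adj I u v = (u ≢ v) × Intersects (I u) (I v)

IsProper : ∀ {n} → Rep n → Set
IsProper {n} I = (u v : Fin n) → ¬ ProperlyContainedIn (I u) (I v)

data Reach {n} (I : Rep n) (P : Fin n → Set) : Fin n → Fin n → Set where
  done : ∀ {u} → P u → Reach I P u u
  step : ∀ {u v w} → P u → Adj I u v → Reach I P v w → Reach I P u w

IsConnected : ∀ {n} → Rep n → Set
IsConnected {n} I = (u v : Fin n) → Reach I (λ _ → ⊤) u v

IsClique : ∀ {n} → Rep n → Subset n → Set
IsClique {n} I S = (u v : Fin n) → u ∈ S → v ∈ S → u ≢ v → Adj I u v

IsCliqueNumber : ∀ {n} → Rep n → ℕ → Set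
IsCliqueNumber {n} I ω =
  (Σ (Subset n) λ S → IsClique I S × ∣ S ∣ ≡ ω) ×
  ((S : Subset n) → IsClique I S → ∣ S ∣ ≤ ω)

⌈_/_⌉ : (a b : ℕ) → .{{NonZero b}} → ℕ
⌈ a / b ⌉ = (a + b ∸ 1) / b

partOf : ∀ {n t} → (Fin n → Fin t) → Fin t → Subset n
partOf label i = tabulate (λ v → does (label v ≟ i))

-- A [λ , C]-partition, given as a labelling of the vertices by t part labels,
-- each part nonempty, inducing a connected subgraph, of size ≤ C, and every
-- clique meeting at most λ parts.
IsPartition : ∀ {n} → Rep n → (λ' C : ℕ) → (t : ℕ) → (Fin n → Fin t) → Set
IsPartition {n} I λ' C t label =
  ((i : Fin t) → ∃[ v ] label v ≡ i) ×
  ((i : Fin t) (u v : Fin n) → label u ≡ i → label v ≡ i →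
      Reach I (λ w → label w ≡ i) u v) ×
  ((i : Fin t) → ∣ partOf label i ∣ ≤ C) ×
  ((S : Subset n) → IsClique I S →
      (M : Subset t) → ((j : Fin t) → (j ∈ M → ∃[ v ] (v ∈ S × label v ≡ j))
                                    × (∃[ v ] (v ∈ S × label v ≡ j) → j ∈ M)) →
      ∣ M ∣ ≤ λ')

module Submission where

-- Sort the vertices by left endpoint, breaking ties by index, and let  rank v ∈ {0,…,n-1}
-- be the position of v in this order.  Since no interval properly contains another, right
-- endpoints increase together with left endpoints; so if x and y intersect, any two vertices
-- whose ranks lie between those of x and y intersect too.  This has two consequences:
--   * in a connected graph vertices of consecutive ranks are adjacent, hence every range of
--     consecutive ranks induces a connected subgraph;
--   * the ranks of a clique lie in a window of ω consecutive ranks (the full window between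
--     the extreme vertices of a clique is itself a clique).
-- The partition cuts the sorted order into blocks of C = c + 1 consecutive vertices: v gets
-- label ⌊rank v / C⌋.  Blocks are nonempty, connected and of size ≤ C, and a window of ω
-- consecutive ranks meets at most ⌈(ω + C - 1) / C⌉ = ⌊(ω + 2c) / C⌋ blocks.

open import Defs
open import Data.Nat using (ℕ; suc; _+_; _∸_)
open import Data.Fin using (Fin)
open import Data.Product using (Σ)

open import Data.Nat using (zero; _*_; _≤_; _<_; z≤n; s≤s; s≤s⁻¹; z<s; _/_; _%_; NonZero; _≤?_; _<?_)
open import Data.Nat.Properties hiding (_≟_; _≤?_)
open import Data.Nat.DivMod
open import Data.Fin as F using (zero; suc; toℕ; fromℕ<; punchOut)
import Data.Fin.Properties as FP
open import Data.Fin.Subset using (Subset; _∈_; _⊆_; ∣_∣; ⊤; ⊥; _-_; inside; outside)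
import Data.Fin.Subset.Properties as SP
open import Data.Vec using ([]; _∷_; tabulate; here; there)
open import Data.Vec.Properties using (lookup⇒[]=; []=⇒lookup; lookup∘tabulate)
open import Data.Rational using (ℚ) renaming (_≤_ to _≤ℚ_; _<_ to _<ℚ_)
import Data.Rational as Q
import Data.Rational.Properties as QP
open import Data.Product using (_×_; _,_; proj₁; proj₂; ∃; ∃-syntax; swap; map₂)
open import Data.Sum using (_⊎_; inj₁; inj₂)
open import Data.Empty using (⊥-elim)
open import Relation.Nullary using (¬_; Dec; yes; no; does)
open import Relation.Nullary.Decidable using (dec-true; _×-dec_; _⊎-dec_)
open import Relation.Unary using (Decidable)
open import Relation.Binary using (tri<; tri≈; tri>)
open import Relation.Binary.PropositionalEquality
open import Function.Definitions using (Injective)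

module Filter {n : ℕ} {P : Fin n → Set} (P? : Decidable P) where

  filter : Subset n
  filter = tabulate (λ v → does (P? v))

  ∈-filter⁺ : ∀ {x} → P x → x ∈ filter
  ∈-filter⁺ {x} px =
    lookup⇒[]= x _ (trans (lookup∘tabulate (λ v → does (P? v)) x) (dec-true (P? x) px))

  ∈-filter⁻ : ∀ {x} → x ∈ filter → P x
  ∈-filter⁻ {x} x∈ with P? x | trans (sym (lookup∘tabulate (λ v → does (P? v)) x)) ([]=⇒lookup x∈)
  ... | yes px | _ = px
  ... | no _   | ()

-- A map S → T that is injective on S shows ∣ S ∣ ≤ ∣ T ∣.  Proved by induction on S:
-- the image of the first element is removed from T.
∣∣-injection : ∀ {n m} (S : Subset n) (T : Subset m) (f : ∀ x → x ∈ S → Fin m) →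
  (∀ x p → f x p ∈ T) → (∀ x y p q → f x p ≡ f y q → x ≡ y) → ∣ S ∣ ≤ ∣ T ∣
∣∣-injection [] T f f∈T f-inj = z≤n
∣∣-injection (outside ∷ S) T f f∈T f-inj =
  ∣∣-injection S T (λ x p → f (suc x) (there p)) (λ x p → f∈T (suc x) (there p))
    (λ x y p q e → FP.suc-injective (f-inj _ _ _ _ e))
∣∣-injection (inside ∷ S) T f f∈T f-inj =
  ≤-trans (s≤s (∣∣-injection S (T - f zero here) (λ x p → f (suc x) (there p)) rest∈ rest-inj))
          (SP.x∈p⇒∣p-x∣<∣p∣ (f∈T zero here))
  where
  zero≢suc : ∀ {x : Fin _} → zero ≢ suc x
  zero≢suc ()
  rest∈ : ∀ x p → f (suc x) (there p) ∈ T - f zero here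
  rest∈ x p = SP.x∈p∧x∉q⇒x∈p─q (f∈T _ _)
    (λ m → zero≢suc (sym (f-inj _ _ _ _ (SP.x∈⁅y⁆⇒x≡y _ m))))
  rest-inj : ∀ x y p q → f (suc x) (there p) ≡ f (suc y) (there q) → x ≡ y
  rest-inj x y p q e = FP.suc-injective (f-inj _ _ _ _ e)

∣∣≤-into-Fin : ∀ {n m} (S : Subset n) (f : ∀ x → x ∈ S → Fin m) →
  (∀ x y p q → f x p ≡ f y q → x ≡ y) → ∣ S ∣ ≤ m
∣∣≤-into-Fin {m = m} S f f-inj =
  subst (∣ S ∣ ≤_) (SP.∣⊤∣≡n m) (∣∣-injection S ⊤ f (λ _ _ → SP.∈⊤) f-inj)

Fin-into-∣∣ : ∀ {n m} (T : Subset n) (f : Fin m → Fin n) →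
  (∀ k → f k ∈ T) → Injective _≡_ _≡_ f → m ≤ ∣ T ∣
Fin-into-∣∣ {m = m} T f f∈T f-inj =
  subst (_≤ ∣ T ∣) (SP.∣⊤∣≡n m) (∣∣-injection ⊤ T (λ k _ → f k) (λ k _ → f∈T k) (λ _ _ _ _ → f-inj))

∣∣≤-range : ∀ {t} (M : Subset t) (q L : ℕ) →
  (∀ j → j ∈ M → q ≤ toℕ j × toℕ j ∸ q < L) → ∣ M ∣ ≤ L
∣∣≤-range M q L inRange =
  ∣∣≤-into-Fin M (λ j p → fromℕ< (proj₂ (inRange j p)))
    (λ j j' p p' e → FP.toℕ-injective
      (∸-cancelʳ-≡ (proj₁ (inRange j p)) (proj₁ (inRange j' p')) (FP.fromℕ<-injective _ _ _ _ e)))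

injective⇒surjective : ∀ {m} (f : Fin m → Fin m) → Injective _≡_ _≡_ f → ∀ k → ∃ λ v → f v ≡ k
injective⇒surjective {suc m} f f-inj k with FP.any? (λ v → f v F.≟ k)
... | yes hit = hit
... | no miss = ⊥-elim (1+n≰n (FP.injective⇒≤ g-inj))
  where
  g : Fin (suc m) → Fin m
  g v = punchOut {i = k} {j = f v} (λ e → miss (v , sym e))
  g-inj : Injective _≡_ _≡_ g
  g-inj {x} {y} e =
    f-inj (FP.punchOut-injective {i = k} (λ e → miss (x , sym e)) (λ e → miss (y , sym e)) e)

argmin : ∀ {m} (g : Fin m → ℕ) {P : Fin m → Set} → Decidable P → ∃ P →
  ∃ λ v → P v × (∀ u → P u → g v ≤ g u)
argmin {zero} g P? (() , _)
argmin {suc m} g {P} P? (x , px) with FP.any? (λ u → P? (suc u))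
... | yes inTail = pick (P? zero) (argmin (λ u → g (suc u)) (λ u → P? (suc u)) inTail)
  where
  pick : Dec (P zero) → (∃ λ v → P (suc v) × (∀ u → P (suc u) → g (suc v) ≤ g (suc u))) →
         ∃ λ v → P v × (∀ u → P u → g v ≤ g u)
  pick (no ¬p0) (v , pv , vmin) = suc v , pv , λ { zero p → ⊥-elim (¬p0 p) ; (suc u) pu → vmin u pu }
  pick (yes p0) (v , pv , vmin) with g zero ≤? g (suc v)
  ... | yes le = zero , p0 , λ { zero _ → ≤-refl ; (suc u) pu → ≤-trans le (vmin u pu) }
  ... | no nle = suc v , pv , λ { zero _ → <⇒≤ (≰⇒> nle) ; (suc u) pu → vmin u pu }
... | no ¬inTail = zero , onlyZero x px , λ { zero _ → ≤-refl ; (suc u) pu → ⊥-elim (¬inTail (u , pu)) }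
  where
  onlyZero : ∀ y → P y → P zero
  onlyZero zero py = py
  onlyZero (suc y) py = ⊥-elim (¬inTail (y , py))

%-/-injective : ∀ {a b} d .{{_ : NonZero d}} → a % d ≡ b % d → a / d ≡ b / d → a ≡ b
%-/-injective {a} {b} d e% e/ = begin
  a                   ≡⟨ m≡m%n+[m/n]*n a d ⟩
  a % d + (a / d) * d ≡⟨ cong₂ (λ r q → r + q * d) e% e/ ⟩
  b % d + (b / d) * d ≡⟨ sym (m≡m%n+[m/n]*n b d) ⟩
  b                   ∎
  where open ≡-Reasoning

/-squeeze : ∀ d .{{_ : NonZero d}} {a z b k} → a ≤ z → z ≤ b → a / d ≡ k → b / d ≡ k → z / d ≡ k
/-squeeze d a≤z z≤b refl b/d≡a/d =
  ≤-antisym (subst (_ ≤_) b/d≡a/d (/-monoˡ-≤ d z≤b)) (/-monoˡ-≤ d a≤z)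

-- Blocks of length C = suc c:  block r = ⌊ r / C ⌋.
module Blocks (c : ℕ) where

  C : ℕ
  C = suc c

  m≤[m/C]*C+c : ∀ m → m ≤ (m / C) * C + c
  m≤[m/C]*C+c m = begin
    m                   ≡⟨ m≡m%n+[m/n]*n m C ⟩
    m % C + (m / C) * C ≤⟨ +-monoˡ-≤ _ (s≤s⁻¹ (m%n<n m C)) ⟩
    c + (m / C) * C     ≡⟨ +-comm c _ ⟩
    (m / C) * C + c     ∎
    where open ≤-Reasoning

  -- n items occupy ⌈ n / C ⌉ = ⌊ (n + c) / C ⌋ blocks: every item lies in one of them ...
  block<count : ∀ {r n} → r < n → r / C < (n + c) / C
  block<count {r} {n} r<n =
    subst (_≤ (n + c) / C) (m*n/n≡m (suc (r / C)) C) (/-monoˡ-≤ C (begin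
      C + (r / C) * C ≤⟨ +-monoʳ-≤ C (m/n*n≤m r C) ⟩
      suc c + r       ≡⟨ cong suc (+-comm c r) ⟩
      suc r + c       ≤⟨ +-monoˡ-≤ c r<n ⟩
      n + c           ∎))
    where open ≤-Reasoning

  -- ... and every block contains an item.
  block-start<count : ∀ {i n} → i < (n + c) / C → i * C < n
  block-start<count {i} {n} lt = +-cancelʳ-≤ c (suc (i * C)) n (begin
    suc (i * C) + c    ≡⟨ cong suc (+-comm (i * C) c) ⟩
    suc i * C          ≤⟨ *-monoˡ-≤ C lt ⟩
    ((n + c) / C) * C  ≤⟨ m/n*n≤m (n + c) C ⟩
    n + c              ∎)
    where open ≤-Reasoning

  window-blocks : ∀ {a b w} → a ≤ b → b ∸ a < w → b / C ∸ a / C < (w + c + c) / C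
  window-blocks {a} {b} {w} a≤b span = subst (b / C ∸ a / C <_) (m+n∸m≡n (a / C) L)
      (∸-monoˡ-< (m<n*o⇒m/o<n b<[q+L]*C) (/-monoˡ-≤ C a≤b))
    where
    open ≤-Reasoning
    L : ℕ
    L = (w + c + c) / C
    w+c≤L*C : w + c ≤ L * C
    w+c≤L*C = +-cancelʳ-≤ c (w + c) (L * C) (m≤[m/C]*C+c (w + c + c))
    b<[q+L]*C : b < (a / C + L) * C
    b<[q+L]*C = begin-strict
      b                       ≡⟨ sym (m+[n∸m]≡n a≤b) ⟩
      a + (b ∸ a)             <⟨ +-monoʳ-< a span ⟩
      a + w                   ≤⟨ +-monoˡ-≤ w (m≤[m/C]*C+c a) ⟩
      (a / C) * C + c + w     ≡⟨ +-assoc ((a / C) * C) c w ⟩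
      (a / C) * C + (c + w)   ≡⟨ cong ((a / C) * C +_) (+-comm c w) ⟩
      (a / C) * C + (w + c)   ≤⟨ +-monoʳ-≤ ((a / C) * C) w+c≤L*C ⟩
      (a / C) * C + L * C     ≡⟨ sym (*-distribʳ-+ C (a / C) L) ⟩
      (a / C + L) * C         ∎

  ceil≡ : ∀ ω → ⌈ ω + C ∸ 1 / C ⌉ ≡ (ω + c + c) / C
  ceil≡ ω rewrite +-suc ω c | +-suc (ω + c) c = refl

module _ {n : ℕ} {I : Rep n} {P : Fin n → Set} where

  Reach-source : ∀ {u v} → Reach I P u v → P u
  Reach-source (done pu) = pu
  Reach-source (step pu _ _) = pu

  Reach-++ : ∀ {u v w} → Reach I P u v → Reach I P v w → Reach I P u w
  Reach-++ (done _) r = r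
  Reach-++ (step pu adj r) r' = step pu adj (Reach-++ r r')

  Reach-sym : ∀ {u v} → Reach I P u v → Reach I P v u
  Reach-sym (done pu) = done pu
  Reach-sym (step pu (u≢v , p , q) r) =
    Reach-++ (Reach-sym r) (step (Reach-source r) ((λ e → u≢v (sym e)) , q , p) (done pu))

-- Two members of a clique have intersecting intervals (a vertex meets itself).
clique-intersects : ∀ {n} {I : Rep n} {S : Subset n} → IsClique I S →
  ∀ {u v} → u ∈ S → v ∈ S → Intersects (I u) (I v)
clique-intersects {I = I} cl {u} {v} u∈S v∈S with u F.≟ v
... | yes refl = lo≤hi (I u) , lo≤hi (I u)
... | no u≢v = proj₂ (cl u v u∈S v∈S u≢v)

module ProperRep {n : ℕ} (I : Rep n) (proper : IsProper I) where

  left right : Fin n → ℚ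
  left v = lo (I v)
  right v = hi (I v)

  right-mono : ∀ u v → left u ≤ℚ left v → right u ≤ℚ right v
  right-mono u v lu≤lv with right u Q.≤? right v
  ... | yes ru≤rv = ru≤rv
  ... | no ru≰rv = ⊥-elim (proper v u (lu≤lv , QP.<⇒≤ (QP.≰⇒> ru≰rv) , inj₂ (QP.≰⇒> ru≰rv)))

  intersect-inside : ∀ {x a b y} → left x ≤ℚ left a → left a ≤ℚ left b → left b ≤ℚ left y →
    Intersects (I x) (I y) → Intersects (I a) (I b)
  intersect-inside {x} {a} {b} x≤a a≤b b≤y (_ , ly≤rx) =
    QP.≤-trans a≤b (lo≤hi (I b)) , QP.≤-trans b≤y (QP.≤-trans ly≤rx (right-mono x a x≤a))

  _≺_ : Fin n → Fin n → Set
  u ≺ v = (left u <ℚ left v) ⊎ ((left u ≡ left v) × (toℕ u < toℕ v))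

  _≺?_ : ∀ u v → Dec (u ≺ v)
  u ≺? v = (left u Q.<? left v) ⊎-dec ((left u Q.≟ left v) ×-dec (toℕ u <? toℕ v))

  ≺-irrefl : ∀ {u} → ¬ (u ≺ u)
  ≺-irrefl (inj₁ lu<lu) = QP.<-irrefl refl lu<lu
  ≺-irrefl (inj₂ (_ , u<u)) = <-irrefl refl u<u

  ≺-trans : ∀ {u v w} → u ≺ v → v ≺ w → u ≺ w
  ≺-trans (inj₁ p) (inj₁ q) = inj₁ (QP.<-trans p q)
  ≺-trans {u} (inj₁ p) (inj₂ (e , _)) = inj₁ (subst (left u <ℚ_) e p)
  ≺-trans {w = w} (inj₂ (e , _)) (inj₁ q) = inj₁ (subst (_<ℚ left w) (sym e) q)
  ≺-trans (inj₂ (e , p)) (inj₂ (e' , q)) = inj₂ (trans e e' , <-trans p q)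

  ≺-connex : ∀ {u v} → u ≢ v → (u ≺ v) ⊎ (v ≺ u)
  ≺-connex {u} {v} u≢v with QP.<-cmp (left u) (left v)
  ... | tri< lu<lv _ _ = inj₁ (inj₁ lu<lv)
  ... | tri> _ _ lv<lu = inj₂ (inj₁ lv<lu)
  ... | tri≈ _ lu≡lv _ with <-cmp (toℕ u) (toℕ v)
  ...   | tri< u<v _ _ = inj₁ (inj₂ (lu≡lv , u<v))
  ...   | tri≈ _ u≡v _ = ⊥-elim (u≢v (FP.toℕ-injective u≡v))
  ...   | tri> _ _ v<u = inj₂ (inj₂ (sym lu≡lv , v<u))

  ≺⇒left≤ : ∀ {u v} → u ≺ v → left u ≤ℚ left v
  ≺⇒left≤ (inj₁ lu<lv) = QP.<⇒≤ lu<lv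
  ≺⇒left≤ (inj₂ (lu≡lv , _)) = QP.≤-reflexive lu≡lv

  module Before (v : Fin n) = Filter (_≺? v)

  rank : Fin n → ℕ
  rank v = ∣ Before.filter v ∣

  rank-mono : ∀ {u v} → u ≺ v → rank u < rank v
  rank-mono {u} {v} u≺v = SP.p⊂q⇒∣p∣<∣q∣
    ( (λ w∈ → Before.∈-filter⁺ v (≺-trans (Before.∈-filter⁻ u w∈) u≺v))
    , u , Before.∈-filter⁺ v u≺v , (λ u∈ → ≺-irrefl (Before.∈-filter⁻ u u∈)) )

  rank<n : ∀ v → rank v < n
  rank<n v = subst (rank v <_) (SP.∣⊤∣≡n n)
    (SP.p⊂q⇒∣p∣<∣q∣ ((λ _ → SP.∈⊤) , v , SP.∈⊤ , λ v∈ → ≺-irrefl (Before.∈-filter⁻ v v∈)))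

  rank-injective : ∀ {u v} → rank u ≡ rank v → u ≡ v
  rank-injective {u} {v} e with u F.≟ v
  ... | yes u≡v = u≡v
  ... | no u≢v with ≺-connex u≢v
  ...   | inj₁ u≺v = ⊥-elim (<-irrefl e (rank-mono u≺v))
  ...   | inj₂ v≺u = ⊥-elim (<-irrefl (sym e) (rank-mono v≺u))

  rank≤⇒left≤ : ∀ {u v} → rank u ≤ rank v → left u ≤ℚ left v
  rank≤⇒left≤ {u} {v} le with u F.≟ v
  ... | yes refl = QP.≤-refl
  ... | no u≢v with ≺-connex u≢v
  ...   | inj₁ u≺v = ≺⇒left≤ u≺v
  ...   | inj₂ v≺u = ⊥-elim (≤⇒≯ le (rank-mono v≺u))

  rank-surjective : ∀ k → k < n → ∃ λ v → rank v ≡ k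
  rank-surjective k k<n =
    map₂ (FP.fromℕ<-injective _ _ _ _) (injective⇒surjective rank-Fin rank-Fin-inj (fromℕ< k<n))
    where
    rank-Fin : Fin n → Fin n
    rank-Fin v = fromℕ< (rank<n v)
    rank-Fin-inj : Injective _≡_ _≡_ rank-Fin
    rank-Fin-inj e = rank-injective (FP.fromℕ<-injective _ _ _ _ e)

  Between : Fin n → Fin n → Fin n → Set
  Between x y z = rank x ≤ rank z × rank z ≤ rank y

  between? : ∀ x y z → Dec (Between x y z)
  between? x y z = (rank x ≤? rank z) ×-dec (rank z ≤? rank y)

  window : Fin n → Fin n → Subset n
  window x y = Filter.filter (between? x y)

  window-clique : ∀ x y → Intersects (I x) (I y) → IsClique I (window x y)
  window-clique x y x∩y u w u∈ w∈ u≢w = u≢w , meet (≤-total (rank u) (rank w))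
    where
    open Filter (between? x y)
    meet : rank u ≤ rank w ⊎ rank w ≤ rank u → Intersects (I u) (I w)
    meet (inj₁ u≤w) = intersect-inside (rank≤⇒left≤ (proj₁ (∈-filter⁻ u∈))) (rank≤⇒left≤ u≤w)
                                       (rank≤⇒left≤ (proj₂ (∈-filter⁻ w∈))) x∩y
    meet (inj₂ w≤u) = swap (intersect-inside (rank≤⇒left≤ (proj₁ (∈-filter⁻ w∈))) (rank≤⇒left≤ w≤u)
                                             (rank≤⇒left≤ (proj₂ (∈-filter⁻ u∈))) x∩y)

  ∣window∣ : ∀ x y → rank x ≤ rank y → suc (rank y ∸ rank x) ≤ ∣ window x y ∣
  ∣window∣ x y x≤y = Fin-into-∣∣ (window x y) at at∈ at-inj
    where
    open Filter (between? x y)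
    position≤ : (k : Fin (suc (rank y ∸ rank x))) → rank x + toℕ k ≤ rank y
    position≤ k = subst (rank x + toℕ k ≤_) (m+[n∸m]≡n x≤y) (+-monoʳ-≤ (rank x) (s≤s⁻¹ (FP.toℕ<n k)))
    vertexAt : (k : Fin (suc (rank y ∸ rank x))) → ∃ λ v → rank v ≡ rank x + toℕ k
    vertexAt k = rank-surjective _ (≤-<-trans (position≤ k) (rank<n y))
    at : Fin (suc (rank y ∸ rank x)) → Fin n
    at k = proj₁ (vertexAt k)
    at∈ : ∀ k → at k ∈ window x y
    at∈ k = ∈-filter⁺ ( subst (rank x ≤_) (sym (proj₂ (vertexAt k))) (m≤m+n _ _)
                      , subst (_≤ rank y) (sym (proj₂ (vertexAt k))) (position≤ k))
    at-inj : Injective _≡_ _≡_ at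
    at-inj {k} {k'} e = FP.toℕ-injective (+-cancelˡ-≡ (rank x) _ _
      (trans (sym (proj₂ (vertexAt k))) (trans (cong rank e) (proj₂ (vertexAt k')))))

  rank-span : ∀ {ω} → IsCliqueNumber I ω → ∀ {x y} → Intersects (I x) (I y) →
    rank x ≤ rank y → rank y ∸ rank x < ω
  rank-span (_ , maximal) {x} {y} x∩y x≤y =
    ≤-trans (∣window∣ x y x≤y) (maximal (window x y) (window-clique x y x∩y))

  module _ (connected : IsConnected I) where

    -- A path from below position rank a + 1 to above it has an edge jumping over it; that edge
    -- spans the two vertices a and b at positions rank a and rank a + 1, so they intersect.
    crossing : ∀ {Q : Fin n → Set} {x y} a b → Reach I Q x y → rank x ≤ rank a → rank b ≤ rank y →
      rank b ≡ suc (rank a) → Intersects (I a) (I b)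
    crossing a b (done _) x≤a b≤x e =
      ⊥-elim (<⇒≱ (subst (rank a <_) (sym e) (n<1+n _)) (≤-trans b≤x x≤a))
    crossing a b (step {v = v} _ x~v r) x≤a b≤y e with rank v ≤? rank a
    ... | yes v≤a = crossing a b r v≤a b≤y e
    ... | no v≰a = intersect-inside (rank≤⇒left≤ x≤a)
                     (rank≤⇒left≤ (subst (rank a ≤_) (sym e) (n≤1+n _)))
                     (rank≤⇒left≤ (subst (_≤ rank v) (sym e) (≰⇒> v≰a))) (proj₂ x~v)

    consecutive-adjacent : ∀ {a b} → rank b ≡ suc (rank a) → Adj I a b
    consecutive-adjacent {a} {b} e =
      (λ { refl → <-irrefl e ≤-refl }) , crossing a b (connected a b) ≤-refl ≤-refl e

    reach-up : ∀ (Q : Fin n → Set) d x y → rank x + d ≡ rank y → (∀ z → Between x y z → Q z) →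
      Reach I Q x y
    reach-up Q zero x y e inQ with refl ← rank-injective (trans (sym (+-identityʳ (rank x))) e) =
      done (inQ x (≤-refl , ≤-refl))
    reach-up Q (suc d) x y e inQ =
      viaNext (rank-surjective (suc (rank x)) (≤-<-trans x<y (rank<n y)))
      where
      x<y : rank x < rank y
      x<y = subst (rank x <_) e (m<m+n (rank x) z<s)
      viaNext : (∃ λ z → rank z ≡ suc (rank x)) → Reach I Q x y
      viaNext (z , z-next) =
        step (inQ x (≤-refl , <⇒≤ x<y)) (consecutive-adjacent z-next)
             (reach-up Q d z y (trans (cong (_+ d) z-next) (trans (sym (+-suc (rank x) d)) e))
                (λ z' (z≤z' , z'≤y) →
                   inQ z' (≤-trans (n≤1+n _) (subst (_≤ rank z') z-next z≤z') , z'≤y)))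

    window-reach : ∀ (Q : Fin n → Set) x y → rank x ≤ rank y → (∀ z → Between x y z → Q z) →
      Reach I Q x y
    window-reach Q x y x≤y = reach-up Q (rank y ∸ rank x) x y (m+[n∸m]≡n x≤y)

    module BlockPartition (c : ℕ) where
      open Blocks c

      t : ℕ
      t = (n + c) / C

      label : Fin n → Fin t
      label v = fromℕ< (block<count (rank<n v))

      toℕ-label : ∀ v → toℕ (label v) ≡ rank v / C
      toℕ-label v = FP.toℕ-fromℕ< _

      label-surjective : (i : Fin t) → ∃[ v ] label v ≡ i
      label-surjective i with rank-surjective (toℕ i * C) (block-start<count (FP.toℕ<n i))
      ... | v , rank≡ = v , FP.toℕ-injective (begin
        toℕ (label v)  ≡⟨ toℕ-label v ⟩
        rank v / C     ≡⟨ cong (_/ C) rank≡ ⟩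
        toℕ i * C / C  ≡⟨ m*n/n≡m (toℕ i) C ⟩
        toℕ i          ∎)
        where open ≡-Reasoning

      block-convex : ∀ {a b z} → label b ≡ label a → Between a b z → label z ≡ label a
      block-convex {a} {b} {z} same (a≤z , z≤b) = FP.toℕ-injective (trans (toℕ-label z)
        (/-squeeze C a≤z z≤b (sym (toℕ-label a)) (trans (sym (toℕ-label b)) (cong toℕ same))))

      label-connected : (i : Fin t) (u v : Fin n) → label u ≡ i → label v ≡ i →
        Reach I (λ w → label w ≡ i) u v
      label-connected i u v refl lv with ≤-total (rank u) (rank v)
      ... | inj₁ u≤v = window-reach _ u v u≤v (λ _ → block-convex lv)
      ... | inj₂ v≤u =
        Reach-sym (window-reach _ v u v≤u (λ _ btw → trans (block-convex (sym lv) btw) lv))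

      -- Within a block, the remainder rank v % C identifies the vertex.
      label-size : (i : Fin t) → ∣ partOf label i ∣ ≤ C
      label-size i = ∣∣≤-into-Fin (partOf label i) (λ v _ → fromℕ< (m%n<n (rank v) C)) same-remainder
        where
        open Filter (λ v → label v F.≟ i)
        same-remainder : ∀ x y p q → fromℕ< (m%n<n (rank x) C) ≡ fromℕ< (m%n<n (rank y) C) → x ≡ y
        same-remainder x y p q e = rank-injective (%-/-injective C (FP.fromℕ<-injective _ _ _ _ e)
          (trans (sym (toℕ-label x)) (trans (cong toℕ (trans (∈-filter⁻ p) (sym (∈-filter⁻ q))))
                 (toℕ-label y))))

      -- The labels met by a clique S lie in a range of ⌊ (ω + 2c) / C ⌋ blocks, starting at the
      -- block of the leftmost vertex of S.
      label-clique : ∀ {ω} → IsCliqueNumber I ω → (S : Subset n) → IsClique I S →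
        (M : Subset t) → (∀ j → j ∈ M → ∃[ v ] (v ∈ S × label v ≡ j)) → ∣ M ∣ ≤ (ω + c + c) / C
      label-clique {ω} cn S clique M M-labels with FP.any? (λ v → v SP.∈? S)
      ... | no S-empty = ≤-trans (SP.p⊆q⇒∣p∣≤∣q∣ M⊆⊥) (≤-trans (≤-reflexive (SP.∣⊥∣≡0 t)) z≤n)
        where
        M⊆⊥ : M ⊆ ⊥
        M⊆⊥ j∈M with M-labels _ j∈M
        ... | v , v∈S , _ = ⊥-elim (S-empty (v , v∈S))
      ... | yes S-inhabited with argmin rank (λ v → v SP.∈? S) S-inhabited
      ...   | m , m∈S , m-leftmost = ∣∣≤-range M (rank m / C) ((ω + c + c) / C) inRange
        where
        inRange : ∀ j → j ∈ M → rank m / C ≤ toℕ j × toℕ j ∸ rank m / C < (ω + c + c) / C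
        inRange j j∈M with M-labels j j∈M
        ... | v , v∈S , refl rewrite toℕ-label v =
          /-monoˡ-≤ C (m-leftmost v v∈S) ,
          window-blocks (m-leftmost v v∈S)
            (rank-span cn (clique-intersects {I = I} clique m∈S v∈S) (m-leftmost v v∈S))

lemma7 : {n : ℕ} (I : Rep n) → IsProper I → IsConnected I →
    (ω : ℕ) → IsCliqueNumber I ω →
    (c : ℕ) →
    Σ ℕ λ t → Σ (Fin n → Fin t) λ label →
    IsPartition I ⌈ ω + suc c ∸ 1 / suc c ⌉ (suc c) t label
lemma7 I proper connected ω cn c =
  t , label , label-surjective , label-connected , label-size ,
  λ S clique M M-spec → subst (∣ M ∣ ≤_) (sym (ceil≡ ω))
    (label-clique cn S clique M (λ j → proj₁ (M-spec j)))
  where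
  open ProperRep I proper
  open BlockPartition connected c
  open Blocks c
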